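{- Let $M,N,R$ be $\mathrm{CAU}^-_\sigma$ terms with $M\to^*_{\mathrm{CAU}^-_\sigma}N$ and $M\to^*_{\mathrm{CAU}^-_\sigma}R$, and suppose $\sigma\tau(N)$ and $\sigma\tau(R)$ are joinable in $\mathrm{CAU}^-$ (i.e. there is $S$ with $\sigma\tau(N)\to^*_{\mathrm{CAU}^- }S$ and $\sigma\tau(R)\to^*_{\mathrm{CAU}^- }S$). Then $N$ and $R$ are joinable in $\mathrm{CAU}^-_\sigma$ (there is $S'$ with $N\to^*_{\mathrm{CAU}^-_\sigma}S'$ and $R\to^*_{\mathrm{CAU}^-_\sigma}S'$).
   Context: The calculus $\mathrm{CAU}^-_\sigma$ uses nameless (de Bruijn) syntax: Terms $M,N ::= 1 \mid \lambda.M \mid M\,N \mid \mathsf{let}(M,N) \mid !_q M \mid q \triangleright M \mid \iota(\vartheta) \mid M[s] \mid \mathrm{er}(M)$; Trails $q ::= \mathsf{r} \mid \mathsf{t}(q,q') \mid \mathsf{ba} \mid \mathsf{bb} \mid \mathsf{ti} \mid \mathsf{lam}(q) \mid \mathsf{app}(q,q') \mid \mathsf{let}(q,q') \mid \mathsf{tr}(\zeta) \mid \mathrm{tl}(M)$; Substitutions $s,t ::= \langle\rangle \mid {\uparrow} \mid M\cdot s \mid s\circ t$. Index $1$; $\lambda$ binds index 1 of its body; $\mathsf{let}(M,N)$ binds index 1 in $N$; $\vartheta=\{M_1,\dots,M_9\}$ (resp. $\zeta=\{q_1,\dots,q_9\}$) is a family of nine terms (resp. trails) indexed by the trail constructors in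 the order $\mathsf{r},\mathsf{t},\mathsf{ba},\mathsf{bb},\mathsf{ti},\mathsf{lam},\mathsf{app},\mathsf{let},\mathsf{tr}$. $\mathrm{er}$ is explicit trail erasure, $\mathrm{tl}$ explicit trail extraction, $M[s]$ explicit substitution. ${\uparrow}^n={\uparrow}\circ\cdots\circ{\uparrow}$ ($n$ times); $1[{\uparrow}^n]$ is index $n+1$; $M[N]$ abbreviates $M[N\cdot\langle\rangle]$. $\sigma$-rules: $1[\langle\rangle]\to 1$; $1[M\cdot s]\to M$; $(\lambda.M)[s]\to \lambda.(M[1\cdot(s\circ{\uparrow})])$; $(M\,N)[s]\to M[s]\,N[s]$; $(!_qM)[s]\to !_q(M[s])$; $\mathsf{let}(M,N)[s]\to\mathsf{let}(M[s],N[1\cdot(s\circ{\uparrow})])$; $(q\triangleright M)[s]\to q\triangleright(M[s])$; $\iota(\{M_i\})[s]\to\iota(\{M_i[s]\})$; $M[s][t]\to M[s\circ t]$; $\langle\rangle\circ s\to s$; ${\uparrow}\circ\langle\rangle\to{\uparrow}$; ${\uparrow}\circ(M\cdot s)\to s$; $(M\cdot s)\circ t\to M[t]\cdot(s\circ t)$; $(s_1\circ s_2)\circ s_3\to s_1\circ(s_2\circ s_3)$; $\mathrm{er}(1)\to 1$; $\mathrm{er}(1[{\uparrow}^n])\to 1[{\uparrow}^n]$; $\mathrm{er}(\lambda.M)\to\lambda.\mathrm{er}(M)$; $\mathrm{er}(M\,N)\to\mathrm{er}(M)\,\mathrm{er}(N)$; $\mathrm{er}(!_qM)\to !_qM$;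 $\mathrm{er}(\mathsf{let}(M,N))\to\mathsf{let}(\mathrm{er}(M),\mathrm{er}(N))$; $\mathrm{er}(q\triangleright M)\to\mathrm{er}(M)$; $\mathrm{er}(\iota(\{M_i\}))\to\iota(\{\mathrm{er}(M_i)\})$; $\mathrm{tl}(1)\to\mathsf{r}$; $\mathrm{tl}(1[{\uparrow}^n])\to\mathsf{r}$; $\mathrm{tl}(\lambda.M)\to\mathsf{lam}(\mathrm{tl}(M))$; $\mathrm{tl}(M\,N)\to\mathsf{app}(\mathrm{tl}(M),\mathrm{tl}(N))$; $\mathrm{tl}(!_qM)\to\mathsf{r}$; $\mathrm{tl}(\mathsf{let}(M,N))\to\mathsf{let}(\mathrm{tl}(M),\mathrm{tl}(N))$; $\mathrm{tl}(q\triangleright M)\to\mathsf{t}(q,\mathrm{tl}(M))$; $\mathrm{tl}(\iota(\{M_i\}))\to\mathsf{tr}(\{\mathrm{tl}(M_i)\})$. $\tau$-rules: $\mathsf{r}\triangleright M\to M$; $q\triangleright(q'\triangleright M)\to\mathsf{t}(q,q')\triangleright M$; $!_q(q'\triangleright M)\to !_{\mathsf{t}(q,q')}M$; $\lambda.(q\triangleright M)\to\mathsf{lam}(q)\triangleright\lambda.M$; $(q\triangleright M)\,N\to\mathsf{app}(q,\mathsf{r})\triangleright M\,N$; $M\,(q\triangleright N)\to\mathsf{app}(\mathsf{r},q)\triangleright M\,N$; $\mathsf{let}(q\triangleright M,N)\to\mathsf{let}(q,\mathsf{r})\triangleright\mathsf{let}(M,N)$; $\mathsf{let}(M,q\triangleright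 N)\to\mathsf{let}(\mathsf{r},q)\triangleright\mathsf{let}(M,N)$; $\iota(\{M_1,\dots,q\triangleright M_i,\dots,M_9\})\to\mathsf{tr}(\{\mathsf{r},\dots,q,\dots,\mathsf{r}\})\triangleright\iota(\{M_1,\dots,M_9\})$; $\mathsf{t}(q,\mathsf{r})\to q$; $\mathsf{t}(\mathsf{r},q)\to q$; $\mathsf{tr}(\{\mathsf{r},\dots,\mathsf{r}\})\to\mathsf{r}$; $\mathsf{app}(\mathsf{r},\mathsf{r})\to\mathsf{r}$; $\mathsf{lam}(\mathsf{r})\to\mathsf{r}$; $\mathsf{let}(\mathsf{r},\mathsf{r})\to\mathsf{r}$; $\mathsf{t}(\mathsf{t}(q_1,q_2),q_3)\to\mathsf{t}(q_1,\mathsf{t}(q_2,q_3))$; $\mathsf{t}(\mathsf{lam}(q),\mathsf{lam}(q'))\to\mathsf{lam}(\mathsf{t}(q,q'))$; $\mathsf{t}(\mathsf{lam}(q_1),\mathsf{t}(\mathsf{lam}(q_1'),q))\to\mathsf{t}(\mathsf{lam}(\mathsf{t}(q_1,q_1')),q)$; $\mathsf{t}(\mathsf{app}(q_1,q_2),\mathsf{app}(q_1',q_2'))\to\mathsf{app}(\mathsf{t}(q_1,q_1'),\mathsf{t}(q_2,q_2'))$; $\mathsf{t}(\mathsf{app}(q_1,q_2),\mathsf{t}(\mathsf{app}(q_1',q_2'),q))\to\mathsf{t}(\mathsf{app}(\mathsf{t}(q_1,q_1'),\mathsf{t}(q_2,q_2')),q)$; the same two with $\mathsf{let}$ for $\mathsf{app}$;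 $\mathsf{t}(\mathsf{tr}(\{q_i\}),\mathsf{tr}(\{q_i'\}))\to\mathsf{tr}(\{\mathsf{t}(q_i,q_i')\})$; $\mathsf{t}(\mathsf{tr}(\{q_i\}),\mathsf{t}(\mathsf{tr}(\{q_i'\}),q))\to\mathsf{t}(\mathsf{tr}(\{\mathsf{t}(q_i,q_i')\}),q)$. $\sigma$- and $\tau$-rules apply anywhere; $\sigma\cup\tau$ is terminating and confluent and $\sigma\tau(X)$ denotes the normal form of $X$; $\equiv_{\sigma\tau}$ is the equivalence closure of $\sigma\cup\tau$. Inspection of a trail: for a trail $q$ without $\mathrm{tl}$, $q\vartheta$ is defined by $\mathsf{r}\vartheta=\vartheta(\mathsf{r})$, $\mathsf{ba}\vartheta=\vartheta(\mathsf{ba})$, $\mathsf{bb}\vartheta=\vartheta(\mathsf{bb})$, $\mathsf{ti}\vartheta=\vartheta(\mathsf{ti})$, $\mathsf{lam}(q)\vartheta=\vartheta(\mathsf{lam})\,(q\vartheta)$, $c(q,q')\vartheta=\vartheta(c)\,(q\vartheta)\,(q'\vartheta)$ for $c\in\{\mathsf{t},\mathsf{app},\mathsf{let}\}$, $\mathsf{tr}(\{q_1,\dots,q_9\})\vartheta=\vartheta(\mathsf{tr})\,(q_1\vartheta)\cdots(q_9\vartheta)$. Beta-reduction of $\mathrm{CAU}^-_\sigma$: with $F ::= \blacksquare \mid \lambda.F \mid F\,N \mid M\,F \mid \mathsf{let}(F,N) \mid \mathsf{let}(M,F) \mid q\triangleright F \mid \iota(\{\vec M,F,\vec N\}) \mid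 F[s]$: $(\lambda.M)\,N\to_{\mathrm{Beta}}\mathsf{t}(\mathsf{app}(\mathsf{lam}(\mathrm{tl}(M)),\mathrm{tl}(N)),\mathsf{ba})\triangleright\mathrm{er}(M)[\mathrm{er}(N)]$; $\mathsf{let}(!_qM,N)\to_{\mathrm{Beta}}\mathsf{t}(\mathsf{let}(\mathsf{r},\mathrm{tl}(N)),\mathsf{bb})\triangleright\mathrm{er}(N)[q\triangleright M]$; $!_qF[\iota(\vartheta)]\to_{\mathrm{Beta}}!_qF[\mathsf{ti}\triangleright q'\vartheta]$ where $q'=\sigma\tau(\mathsf{t}(q,\mathrm{tl}(F[\iota(\vartheta)])))$; closed under contexts $E_\sigma ::= \blacksquare \mid \lambda.E_\sigma \mid E_\sigma\,N \mid M\,E_\sigma \mid \mathsf{let}(E_\sigma,N) \mid \mathsf{let}(M,E_\sigma) \mid !_qE_\sigma \mid q\triangleright E_\sigma \mid \iota(\{\vec M,E_\sigma,\vec N\}) \mid E_\sigma[s] \mid M[S_\sigma]$, $S_\sigma ::= S_\sigma\circ t \mid s\circ S_\sigma \mid E_\sigma\cdot s \mid M\cdot S_\sigma$ (holes never inside $\mathrm{er}$). $\to_{\mathrm{CAU}^-_\sigma}\;=\;\to_{\mathrm{Beta}}\cup\equiv_{\sigma\tau}$. The calculus $\mathrm{CAU}^-$ (nameless): terms $M ::= 1 \mid 1[{\uparrow}^n] \mid \lambda.M \mid M\,N \mid \mathsf{let}(M,N) \mid !_qM \mid q\triangleright M \mid \iota(\vartheta)$ with trails not containing $\mathrm{tl}$.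 Contexts $E ::= \blacksquare \mid \lambda.E \mid E\,M \mid M\,E \mid \mathsf{let}(E,M) \mid \mathsf{let}(M,E) \mid !_qE \mid q\triangleright E \mid \iota(\{\vec M,E,\vec N\})$; bang-free contexts $F$ are the same without $!_qE$. Principal contractions: $(\lambda.M)\,N\to_\beta\mathsf{ba}\triangleright M\{N\}$; $\mathsf{let}(!_qM,N)\to_\beta\mathsf{bb}\triangleright N\{q\triangleright M\}$; $!_qF[\iota(\vartheta)]\to_\beta !_qF[\mathsf{ti}\triangleright q\vartheta]$; closed under $E$. $M\{N\}$ is standard capture-avoiding de Bruijn substitution of $N$ for index 1 in $M$. $M\to_{\mathrm{CAU}^- }\tau(N)$ whenever $M\to_\beta N$, with $\tau(N)$ the $\tau$-normal form. -}

module Defs where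

open import Data.Nat using (ℕ; zero; suc)
open import Data.Fin using (Fin; #_)
open import Data.Vec using (Vec; []; _∷_; lookup; _[_]≔_; map; zipWith; replicate; toList)
open import Data.List using (foldl)
open import Data.Product using (Σ; ∃; _×_; _,_)
open import Data.Sum using (_⊎_)
open import Relation.Nullary using (¬_)
open import Relation.Binary.PropositionalEquality using (_≡_)
open import Relation.Binary.Construct.Closure.ReflexiveTransitive using (Star)
open import Relation.Binary.Construct.Closure.Equivalence using (EqClosure)

-- Syntax of CAU⁻_σ (nameless).  Families ϑ / ζ are vectors of length 9,
-- indexed by the trail constructors in the order
--   r, t, ba, bb, ti, lam, app, let, tr   (positions 0 … 8).

mutual
  data Tm : Set where
    one  : Tm                          -- the index 1
    lam  : Tm → Tm
    app  : Tm → Tm → Tm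
    letT : Tm → Tm → Tm                -- let(M,N)   (binds index 1 in N)
    bang : Tr → Tm → Tm
    tri  : Tr → Tm → Tm
    iota : Vec Tm 9 → Tm
    sub  : Tm → Sb → Tm
    er   : Tm → Tm

  data Tr : Set where
    r    : Tr
    t    : Tr → Tr → Tr
    ba   : Tr
    bb   : Tr
    ti   : Tr
    lamq : Tr → Tr
    appq : Tr → Tr → Tr
    letq : Tr → Tr → Tr
    trq  : Vec Tr 9 → Tr
    tl   : Tm → Tr

  data Sb : Set where
    nil  : Sb
    up   : Sb
    cons : Tm → Sb → Sb
    comp : Sb → Sb → Sb

-- ups n = ↑^(n+1) = ↑ ∘ (↑ ∘ ( … ∘ ↑))   (right nested, n+1 copies)
ups : ℕ → Sb
ups zero    = up
ups (suc n) = comp up (ups n)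

sub1 : Tm → Tm → Tm
sub1 M N = sub M (cons N nil)

data SigmaT : Tm → Tm → Set where
  s-id    : SigmaT (sub one nil) one
  s-cons  : ∀ {M s} → SigmaT (sub one (cons M s)) M
  s-lam   : ∀ {M s} → SigmaT (sub (lam M) s) (lam (sub M (cons one (comp s up))))
  s-app   : ∀ {M N s} → SigmaT (sub (app M N) s) (app (sub M s) (sub N s))
  s-bang  : ∀ {q M s} → SigmaT (sub (bang q M) s) (bang q (sub M s))
  s-let   : ∀ {M N s} → SigmaT (sub (letT M N) s)
                                  (letT (sub M s) (sub N (cons one (comp s up))))
  s-tri   : ∀ {q M s} → SigmaT (sub (tri q M) s) (tri q (sub M s))
  s-iota  : ∀ {ms s} → SigmaT (sub (iota ms) s) (iota (map (λ M → sub M s) ms))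
  s-clos  : ∀ {M s u} → SigmaT (sub (sub M s) u) (sub M (comp s u))
  er-one  : SigmaT (er one) one
  er-var  : ∀ n → SigmaT (er (sub one (ups n))) (sub one (ups n))
  er-lam  : ∀ {M} → SigmaT (er (lam M)) (lam (er M))
  er-app  : ∀ {M N} → SigmaT (er (app M N)) (app (er M) (er N))
  er-bang : ∀ {q M} → SigmaT (er (bang q M)) (bang q M)
  er-let  : ∀ {M N} → SigmaT (er (letT M N)) (letT (er M) (er N))
  er-tri  : ∀ {q M} → SigmaT (er (tri q M)) (er M)
  er-iota : ∀ {ms} → SigmaT (er (iota ms)) (iota (map er ms))

data SigmaQ : Tr → Tr → Set where
  tl-one  : SigmaQ (tl one) r
  tl-var  : ∀ n → SigmaQ (tl (sub one (ups n))) r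
  tl-lam  : ∀ {M} → SigmaQ (tl (lam M)) (lamq (tl M))
  tl-app  : ∀ {M N} → SigmaQ (tl (app M N)) (appq (tl M) (tl N))
  tl-bang : ∀ {q M} → SigmaQ (tl (bang q M)) r
  tl-let  : ∀ {M N} → SigmaQ (tl (letT M N)) (letq (tl M) (tl N))
  tl-tri  : ∀ {q M} → SigmaQ (tl (tri q M)) (t q (tl M))
  tl-iota : ∀ {ms} → SigmaQ (tl (iota ms)) (trq (map tl ms))

data SigmaS : Sb → Sb → Set where
  c-nil   : ∀ {s} → SigmaS (comp nil s) s
  c-upnil : SigmaS (comp up nil) up
  c-upcons : ∀ {M s} → SigmaS (comp up (cons M s)) s
  c-cons  : ∀ {M s u} → SigmaS (comp (cons M s) u) (cons (sub M u) (comp s u))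
  c-assoc : ∀ {s₁ s₂ s₃} → SigmaS (comp (comp s₁ s₂) s₃) (comp s₁ (comp s₂ s₃))

data TauT : Tm → Tm → Set where
  τ-r     : ∀ {M} → TauT (tri r M) M
  τ-tt    : ∀ {q q' M} → TauT (tri q (tri q' M)) (tri (t q q') M)
  τ-bang  : ∀ {q q' M} → TauT (bang q (tri q' M)) (bang (t q q') M)
  τ-lam   : ∀ {q M} → TauT (lam (tri q M)) (tri (lamq q) (lam M))
  τ-appL  : ∀ {q M N} → TauT (app (tri q M) N) (tri (appq q r) (app M N))
  τ-appR  : ∀ {q M N} → TauT (app M (tri q N)) (tri (appq r q) (app M N))
  τ-letL  : ∀ {q M N} → TauT (letT (tri q M) N) (tri (letq q r) (letT M N))
  τ-letR  : ∀ {q M N} → TauT (letT M (tri q N)) (tri (letq r q) (letT M N))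
  τ-iota  : ∀ {ms} (i : Fin 9) {q M} → lookup ms i ≡ tri q M →
            TauT (iota ms) (tri (trq (replicate 9 r [ i ]≔ q)) (iota (ms [ i ]≔ M)))

data TauQ : Tr → Tr → Set where
  τ-tr    : ∀ {q} → TauQ (t q r) q
  τ-rt    : ∀ {q} → TauQ (t r q) q
  τ-trr   : TauQ (trq (replicate 9 r)) r
  τ-appr  : TauQ (appq r r) r
  τ-lamr  : TauQ (lamq r) r
  τ-letr  : TauQ (letq r r) r
  τ-assoc : ∀ {q₁ q₂ q₃} → TauQ (t (t q₁ q₂) q₃) (t q₁ (t q₂ q₃))
  τ-lam2  : ∀ {q q'} → TauQ (t (lamq q) (lamq q')) (lamq (t q q'))
  τ-lam3  : ∀ {q₁ q₁' q} → TauQ (t (lamq q₁) (t (lamq q₁') q)) (t (lamq (t q₁ q₁')) q)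
  τ-app2  : ∀ {q₁ q₂ q₁' q₂'} →
            TauQ (t (appq q₁ q₂) (appq q₁' q₂')) (appq (t q₁ q₁') (t q₂ q₂'))
  τ-app3  : ∀ {q₁ q₂ q₁' q₂' q} →
            TauQ (t (appq q₁ q₂) (t (appq q₁' q₂') q)) (t (appq (t q₁ q₁') (t q₂ q₂')) q)
  τ-let2  : ∀ {q₁ q₂ q₁' q₂'} →
            TauQ (t (letq q₁ q₂) (letq q₁' q₂')) (letq (t q₁ q₁') (t q₂ q₂'))
  τ-let3  : ∀ {q₁ q₂ q₁' q₂' q} →
            TauQ (t (letq q₁ q₂) (t (letq q₁' q₂') q)) (t (letq (t q₁ q₁') (t q₂ q₂')) q)
  τ-tr2   : ∀ {qs qs'} → TauQ (t (trq qs) (trq qs')) (trq (zipWith t qs qs'))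
  τ-tr3   : ∀ {qs qs' q} → TauQ (t (trq qs) (t (trq qs') q)) (t (trq (zipWith t qs qs')) q)

data NoRule {A : Set} : A → A → Set where

module Closure (RT : Tm → Tm → Set) (RQ : Tr → Tr → Set) (RS : Sb → Sb → Set) where
  mutual
    data _⇒t_ : Tm → Tm → Set where
      rootT : ∀ {M N} → RT M N → M ⇒t N
      lamC  : ∀ {M M'} → M ⇒t M' → lam M ⇒t lam M'
      appL  : ∀ {M M' N} → M ⇒t M' → app M N ⇒t app M' N
      appR  : ∀ {M N N'} → N ⇒t N' → app M N ⇒t app M N'
      letL  : ∀ {M M' N} → M ⇒t M' → letT M N ⇒t letT M' N
      letR  : ∀ {M N N'} → N ⇒t N' → letT M N ⇒t letT M N'
      bangQ : ∀ {q q' M} → q ⇒q q' → bang q M ⇒t bang q' M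
      bangM : ∀ {q M M'} → M ⇒t M' → bang q M ⇒t bang q M'
      triQ  : ∀ {q q' M} → q ⇒q q' → tri q M ⇒t tri q' M
      triM  : ∀ {q M M'} → M ⇒t M' → tri q M ⇒t tri q M'
      iotaC : ∀ {ms M'} (i : Fin 9) → lookup ms i ⇒t M' → iota ms ⇒t iota (ms [ i ]≔ M')
      subM  : ∀ {M M' s} → M ⇒t M' → sub M s ⇒t sub M' s
      subS  : ∀ {M s s'} → s ⇒s s' → sub M s ⇒t sub M s'
      erC   : ∀ {M M'} → M ⇒t M' → er M ⇒t er M'

    data _⇒q_ : Tr → Tr → Set where
      rootQ : ∀ {q q'} → RQ q q' → q ⇒q q'
      tL    : ∀ {q q' p} → q ⇒q q' → t q p ⇒q t q' p
      tR    : ∀ {q p p'} → p ⇒q p' → t q p ⇒q t q p'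
      lamqC : ∀ {q q'} → q ⇒q q' → lamq q ⇒q lamq q'
      appqL : ∀ {q q' p} → q ⇒q q' → appq q p ⇒q appq q' p
      appqR : ∀ {q p p'} → p ⇒q p' → appq q p ⇒q appq q p'
      letqL : ∀ {q q' p} → q ⇒q q' → letq q p ⇒q letq q' p
      letqR : ∀ {q p p'} → p ⇒q p' → letq q p ⇒q letq q p'
      trqC  : ∀ {qs q'} (i : Fin 9) → lookup qs i ⇒q q' → trq qs ⇒q trq (qs [ i ]≔ q')
      tlC   : ∀ {M M'} → M ⇒t M' → tl M ⇒q tl M'

    data _⇒s_ : Sb → Sb → Set where
      rootS : ∀ {s s'} → RS s s' → s ⇒s s'
      consM : ∀ {M M' s} → M ⇒t M' → cons M s ⇒s cons M' s
      consS : ∀ {M s s'} → s ⇒s s' → cons M s ⇒s cons M s'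
      compL : ∀ {s s' u} → s ⇒s s' → comp s u ⇒s comp s' u
      compR : ∀ {s u u'} → u ⇒s u' → comp s u ⇒s comp s u'

StT : Tm → Tm → Set
StT M N = SigmaT M N ⊎ TauT M N

StQ : Tr → Tr → Set
StQ q q' = SigmaQ q q' ⊎ TauQ q q'

module ST = Closure StT StQ SigmaS
module TA = Closure TauT TauQ NoRule

open ST public using () renaming (_⇒t_ to _→στ_; _⇒q_ to _→στq_)
open TA public using () renaming (_⇒t_ to _→τ_)

NormalT : Tm → Set
NormalT M = ∀ N → ¬ (M →στ N)

NormalQ : Tr → Set
NormalQ q = ∀ q' → ¬ (q →στq q')

IsστNF : Tm → Tm → Set
IsστNF X Y = Star _→στ_ X Y × NormalT Y

IsστNFq : Tr → Tr → Set
IsστNFq X Y = Star _→στq_ X Y × NormalQ Y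

-- Syntax of CAU⁻ (nameless, no explicit substitution, no er, no tl).
-- The index 1 is  v 0 , and the index n+1 = 1[↑^n] (n ≥ 1) is  v n .

mutual
  data PTr : Set where
    r⁻    : PTr
    t⁻    : PTr → PTr → PTr
    ba⁻   : PTr
    bb⁻   : PTr
    ti⁻   : PTr
    lamq⁻ : PTr → PTr
    appq⁻ : PTr → PTr → PTr
    letq⁻ : PTr → PTr → PTr
    trq⁻  : Vec PTr 9 → PTr

data PTm : Set where
  v     : ℕ → PTm
  lam⁻  : PTm → PTm
  app⁻  : PTm → PTm → PTm
  let⁻  : PTm → PTm → PTm
  bang⁻ : PTr → PTm → PTm
  tri⁻  : PTr → PTm → PTm
  iota⁻ : Vec PTm 9 → PTm

mutual
  embQ : PTr → Tr
  embQ r⁻ = r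
  embQ (t⁻ q p) = t (embQ q) (embQ p)
  embQ ba⁻ = ba
  embQ bb⁻ = bb
  embQ ti⁻ = ti
  embQ (lamq⁻ q) = lamq (embQ q)
  embQ (appq⁻ q p) = appq (embQ q) (embQ p)
  embQ (letq⁻ q p) = letq (embQ q) (embQ p)
  embQ (trq⁻ qs) = trq (embQV qs)

  embQV : ∀ {n} → Vec PTr n → Vec Tr n
  embQV [] = []
  embQV (q ∷ qs) = embQ q ∷ embQV qs

mutual
  emb : PTm → Tm
  emb (v zero) = one
  emb (v (suc n)) = sub one (ups n)
  emb (lam⁻ M) = lam (emb M)
  emb (app⁻ M N) = app (emb M) (emb N)
  emb (let⁻ M N) = letT (emb M) (emb N)
  emb (bang⁻ q M) = bang (embQ q) (emb M)
  emb (tri⁻ q M) = tri (embQ q) (emb M)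
  emb (iota⁻ ms) = iota (embV ms)

  embV : ∀ {n} → Vec PTm n → Vec Tm n
  embV [] = []
  embV (M ∷ ms) = emb M ∷ embV ms

module _ {A : Set} (ap : A → A → A) where
  mutual
    inspect : PTr → Vec A 9 → A
    inspect r⁻ θ = lookup θ (# 0)
    inspect (t⁻ q p) θ = ap (ap (lookup θ (# 1)) (inspect q θ)) (inspect p θ)
    inspect ba⁻ θ = lookup θ (# 2)
    inspect bb⁻ θ = lookup θ (# 3)
    inspect ti⁻ θ = lookup θ (# 4)
    inspect (lamq⁻ q) θ = ap (lookup θ (# 5)) (inspect q θ)
    inspect (appq⁻ q p) θ = ap (ap (lookup θ (# 6)) (inspect q θ)) (inspect p θ)
    inspect (letq⁻ q p) θ = ap (ap (lookup θ (# 7)) (inspect q θ)) (inspect p θ)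
    inspect (trq⁻ qs) θ = foldl ap (lookup θ (# 8)) (toList (inspectV qs θ))

    inspectV : ∀ {n} → Vec PTr n → Vec A 9 → Vec A n
    inspectV [] θ = []
    inspectV (q ∷ qs) θ = inspect q θ ∷ inspectV qs θ

-- bang-free contexts F of CAU⁻_σ  (the hole of ι at position i;
-- the i-th entry of the vector is ignored)
data FCtx : Set where
  hole  : FCtx
  lamF  : FCtx → FCtx
  appFL : FCtx → Tm → FCtx
  appFR : Tm → FCtx → FCtx
  letFL : FCtx → Tm → FCtx
  letFR : Tm → FCtx → FCtx
  triF  : Tr → FCtx → FCtx
  iotaF : Vec Tm 9 → Fin 9 → FCtx → FCtx
  subF  : FCtx → Sb → FCtx

plugF : FCtx → Tm → Tm
plugF hole X = X
plugF (lamF F) X = lam (plugF F X)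
plugF (appFL F N) X = app (plugF F X) N
plugF (appFR M F) X = app M (plugF F X)
plugF (letFL F N) X = letT (plugF F X) N
plugF (letFR M F) X = letT M (plugF F X)
plugF (triF q F) X = tri q (plugF F X)
plugF (iotaF ms i F) X = iota (ms [ i ]≔ plugF F X)
plugF (subF F s) X = sub (plugF F X) s

data BetaRoot : Tm → Tm → Set where
  b-lam  : ∀ {M N} →
           BetaRoot (app (lam M) N)
                    (tri (t (appq (lamq (tl M)) (tl N)) ba) (sub1 (er M) (er N)))
  b-let  : ∀ {q M N} →
           BetaRoot (letT (bang q M) N)
                    (tri (t (letq r (tl N)) bb) (sub1 (er N) (tri q M)))
  b-iota : ∀ {q} (F : FCtx) (θ : Vec Tm 9) (q' : PTr) →
           IsστNFq (t q (tl (plugF F (iota θ)))) (embQ q') →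
           BetaRoot (bang q (plugF F (iota θ)))
                    (bang q (plugF F (tri ti (inspect app q' θ))))

mutual
  data _→B_ : Tm → Tm → Set where
    rootB : ∀ {M N} → BetaRoot M N → M →B N
    lamB  : ∀ {M M'} → M →B M' → lam M →B lam M'
    appBL : ∀ {M M' N} → M →B M' → app M N →B app M' N
    appBR : ∀ {M N N'} → N →B N' → app M N →B app M N'
    letBL : ∀ {M M' N} → M →B M' → letT M N →B letT M' N
    letBR : ∀ {M N N'} → N →B N' → letT M N →B letT M N'
    bangB : ∀ {q M M'} → M →B M' → bang q M →B bang q M'
    triB  : ∀ {q M M'} → M →B M' → tri q M →B tri q M'
    iotaB : ∀ {ms M'} (i : Fin 9) → lookup ms i →B M' → iota ms →B iota (ms [ i ]≔ M')
    subBM : ∀ {M M' s} → M →B M' → sub M s →B sub M' s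
    subBS : ∀ {M s s'} → s →Bs s' → sub M s →B sub M s'

  data _→Bs_ : Sb → Sb → Set where
    compBL : ∀ {s s' u} → s →Bs s' → comp s u →Bs comp s' u
    compBR : ∀ {s u u'} → u →Bs u' → comp s u →Bs comp s u'
    consBM : ∀ {M M' s} → M →B M' → cons M s →Bs cons M' s
    consBS : ∀ {M s s'} → s →Bs s' → cons M s →Bs cons M s'

_→σ_ : Tm → Tm → Set
M →σ N = (M →B N) ⊎ EqClosure _→στ_ M N

_→σ*_ : Tm → Tm → Set
_→σ*_ = Star _→σ_

ext : (ℕ → ℕ) → ℕ → ℕ
ext ρ zero = zero
ext ρ (suc n) = suc (ρ n)

mutual
  rename : (ℕ → ℕ) → PTm → PTm
  rename ρ (v n) = v (ρ n)
  rename ρ (lam⁻ M) = lam⁻ (rename (ext ρ) M)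
  rename ρ (app⁻ M N) = app⁻ (rename ρ M) (rename ρ N)
  rename ρ (let⁻ M N) = let⁻ (rename ρ M) (rename (ext ρ) N)
  rename ρ (bang⁻ q M) = bang⁻ q (rename ρ M)
  rename ρ (tri⁻ q M) = tri⁻ q (rename ρ M)
  rename ρ (iota⁻ ms) = iota⁻ (renameV ρ ms)

  renameV : ∀ {n} → (ℕ → ℕ) → Vec PTm n → Vec PTm n
  renameV ρ [] = []
  renameV ρ (M ∷ ms) = rename ρ M ∷ renameV ρ ms

exts : (ℕ → PTm) → ℕ → PTm
exts σ zero = v zero
exts σ (suc n) = rename suc (σ n)

mutual
  subst : (ℕ → PTm) → PTm → PTm
  subst σ (v n) = σ n
  subst σ (lam⁻ M) = lam⁻ (subst (exts σ) M)
  subst σ (app⁻ M N) = app⁻ (subst σ M) (subst σ N)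
  subst σ (let⁻ M N) = let⁻ (subst σ M) (subst (exts σ) N)
  subst σ (bang⁻ q M) = bang⁻ q (subst σ M)
  subst σ (tri⁻ q M) = tri⁻ q (subst σ M)
  subst σ (iota⁻ ms) = iota⁻ (substV σ ms)

  substV : ∀ {n} → (ℕ → PTm) → Vec PTm n → Vec PTm n
  substV σ [] = []
  substV σ (M ∷ ms) = subst σ M ∷ substV σ ms

single : PTm → ℕ → PTm
single N zero = N
single N (suc n) = v n

_⟪_⟫ : PTm → PTm → PTm
M ⟪ N ⟫ = subst (single N) M

data PFCtx : Set where
  hole⁻  : PFCtx
  lamF⁻  : PFCtx → PFCtx
  appFL⁻ : PFCtx → PTm → PFCtx
  appFR⁻ : PTm → PFCtx → PFCtx
  letFL⁻ : PFCtx → PTm → PFCtx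
  letFR⁻ : PTm → PFCtx → PFCtx
  triF⁻  : PTr → PFCtx → PFCtx
  iotaF⁻ : Vec PTm 9 → Fin 9 → PFCtx → PFCtx

plugF⁻ : PFCtx → PTm → PTm
plugF⁻ hole⁻ X = X
plugF⁻ (lamF⁻ F) X = lam⁻ (plugF⁻ F X)
plugF⁻ (appFL⁻ F N) X = app⁻ (plugF⁻ F X) N
plugF⁻ (appFR⁻ M F) X = app⁻ M (plugF⁻ F X)
plugF⁻ (letFL⁻ F N) X = let⁻ (plugF⁻ F X) N
plugF⁻ (letFR⁻ M F) X = let⁻ M (plugF⁻ F X)
plugF⁻ (triF⁻ q F) X = tri⁻ q (plugF⁻ F X)
plugF⁻ (iotaF⁻ ms i F) X = iota⁻ (ms [ i ]≔ plugF⁻ F X)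

data βRoot : PTm → PTm → Set where
  β-lam  : ∀ {M N} → βRoot (app⁻ (lam⁻ M) N) (tri⁻ ba⁻ (M ⟪ N ⟫))
  β-let  : ∀ {q M N} → βRoot (let⁻ (bang⁻ q M) N) (tri⁻ bb⁻ (N ⟪ tri⁻ q M ⟫))
  β-iota : ∀ {q} (F : PFCtx) (θ : Vec PTm 9) →
           βRoot (bang⁻ q (plugF⁻ F (iota⁻ θ)))
                 (bang⁻ q (plugF⁻ F (tri⁻ ti⁻ (inspect app⁻ q θ))))

data _→β_ : PTm → PTm → Set where
  rootβ : ∀ {M N} → βRoot M N → M →β N
  lamβ  : ∀ {M M'} → M →β M' → lam⁻ M →β lam⁻ M'
  appβL : ∀ {M M' N} → M →β M' → app⁻ M N →β app⁻ M' N
  appβR : ∀ {M N N'} → N →β N' → app⁻ M N →β app⁻ M N'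
  letβL : ∀ {M M' N} → M →β M' → let⁻ M N →β let⁻ M' N
  letβR : ∀ {M N N'} → N →β N' → let⁻ M N →β let⁻ M N'
  bangβ : ∀ {q M M'} → M →β M' → bang⁻ q M →β bang⁻ q M'
  triβ  : ∀ {q M M'} → M →β M' → tri⁻ q M →β tri⁻ q M'
  iotaβ : ∀ {ms M'} (i : Fin 9) → lookup ms i →β M' → iota⁻ ms →β iota⁻ (ms [ i ]≔ M')

-- N' is the τ-normal form τ(N) of the CAU⁻ term N
-- (τ-rules are the same rules as above, read on the embedded syntax)
IsτNF : PTm → PTm → Set
IsτNF N N' = Star _→τ_ (emb N) (emb N') × (∀ X → ¬ (emb N' →τ X))

_→⁻_ : PTm → PTm → Set
M →⁻ N' = ∃ λ N → (M →β N) × IsτNF N N'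

_→⁻*_ : PTm → PTm → Set
_→⁻*_ = Star _→⁻_

-- N reaches σ(N) = emb N′ and R reaches emb R′ by στ-steps alone, so it suffices to simulate
-- every CAU⁻ step out of a τ-normal term by one Beta step followed by a στ-conversion; both
-- N and R then reach emb S.  The simulation works because on the embedding of a τ-normal term
-- er is the identity and tl collapses to r up to στ (a τ-normal term carries ▷ only at its
-- root), while the σ-rules compute de Bruijn substitution on embedded terms.
module Submission where

open import Defs
open import Data.Empty using (⊥-elim)
open import Data.Fin using (Fin; zero; suc; #_)
open import Data.Nat using (ℕ; zero; suc)
open import Data.List using (List; []; _∷_; foldl) renaming (map to mapₗ)
open import Data.Product using (∃; ∃₂; _×_; _,_; proj₁; proj₂)
open import Data.Sum using (inj₁; inj₂)
open import Data.Vec using (Vec; []; _∷_; lookup; _[_]≔_; map; replicate; toList)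
open import Data.Vec.Relation.Binary.Pointwise.Inductive as Pointwise using (Pointwise; []; _∷_)
open import Data.Vec.Relation.Unary.All using (All; []; _∷_)
open import Function using (_∘_)
open import Relation.Binary.Definitions using (Reflexive)
open import Relation.Nullary using (¬_)
open import Relation.Binary.PropositionalEquality as ≡
  using (_≡_; refl; sym; trans; cong; cong₂; subst₂)
open import Relation.Binary.Construct.Closure.ReflexiveTransitive as Star
  using (Star; ε; _◅_; _◅◅_)
open import Relation.Binary.Construct.Closure.Symmetric as Sym using (SymClosure; fwd; bwd)
open import Relation.Binary.Construct.Closure.Equivalence as Eq using (EqClosure)

module ClosureMonotone
  {RT RT′ : Tm → Tm → Set} {RQ RQ′ : Tr → Tr → Set} {RS RS′ : Sb → Sb → Set}
  (RT⊆RT′ : ∀ {M N} → RT M N → RT′ M N)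
  (RQ⊆RQ′ : ∀ {q q′} → RQ q q′ → RQ′ q q′)
  (RS⊆RS′ : ∀ {s s′} → RS s s′ → RS′ s s′) where

  private
    module C  = Closure RT RQ RS
    module C′ = Closure RT′ RQ′ RS′

  mutual
    ⇒t-mono : ∀ {M N} → M C.⇒t N → M C′.⇒t N
    ⇒t-mono (C.rootT x)   = C′.rootT (RT⊆RT′ x)
    ⇒t-mono (C.lamC p)    = C′.lamC (⇒t-mono p)
    ⇒t-mono (C.appL p)    = C′.appL (⇒t-mono p)
    ⇒t-mono (C.appR p)    = C′.appR (⇒t-mono p)
    ⇒t-mono (C.letL p)    = C′.letL (⇒t-mono p)
    ⇒t-mono (C.letR p)    = C′.letR (⇒t-mono p)
    ⇒t-mono (C.bangQ p)   = C′.bangQ (⇒q-mono p)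
    ⇒t-mono (C.bangM p)   = C′.bangM (⇒t-mono p)
    ⇒t-mono (C.triQ p)    = C′.triQ (⇒q-mono p)
    ⇒t-mono (C.triM p)    = C′.triM (⇒t-mono p)
    ⇒t-mono (C.iotaC i p) = C′.iotaC i (⇒t-mono p)
    ⇒t-mono (C.subM p)    = C′.subM (⇒t-mono p)
    ⇒t-mono (C.subS p)    = C′.subS (⇒s-mono p)
    ⇒t-mono (C.erC p)     = C′.erC (⇒t-mono p)

    ⇒q-mono : ∀ {q q′} → q C.⇒q q′ → q C′.⇒q q′
    ⇒q-mono (C.rootQ x)  = C′.rootQ (RQ⊆RQ′ x)
    ⇒q-mono (C.tL p)     = C′.tL (⇒q-mono p)
    ⇒q-mono (C.tR p)     = C′.tR (⇒q-mono p)
    ⇒q-mono (C.lamqC p)  = C′.lamqC (⇒q-mono p)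
    ⇒q-mono (C.appqL p)  = C′.appqL (⇒q-mono p)
    ⇒q-mono (C.appqR p)  = C′.appqR (⇒q-mono p)
    ⇒q-mono (C.letqL p)  = C′.letqL (⇒q-mono p)
    ⇒q-mono (C.letqR p)  = C′.letqR (⇒q-mono p)
    ⇒q-mono (C.trqC i p) = C′.trqC i (⇒q-mono p)
    ⇒q-mono (C.tlC p)    = C′.tlC (⇒t-mono p)

    ⇒s-mono : ∀ {s s′} → s C.⇒s s′ → s C′.⇒s s′
    ⇒s-mono (C.rootS x) = C′.rootS (RS⊆RS′ x)
    ⇒s-mono (C.consM p) = C′.consM (⇒t-mono p)
    ⇒s-mono (C.consS p) = C′.consS (⇒s-mono p)
    ⇒s-mono (C.compL p) = C′.compL (⇒s-mono p)
    ⇒s-mono (C.compR p) = C′.compR (⇒s-mono p)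

τ⇒στ : ∀ {M N} → M →τ N → M →στ N
τ⇒στ = ClosureMonotone.⇒t-mono inj₂ inj₂ (λ ())

σ-step : ∀ {M N} → SigmaT M N → M →στ N
σ-step = ST.rootT ∘ inj₁

σq-step : ∀ {q q′} → SigmaQ q q′ → q →στq q′
σq-step = ST.rootQ ∘ inj₁

τq-step : ∀ {q q′} → TauQ q q′ → q →στq q′
τq-step = ST.rootQ ∘ inj₂

no-σ-on-embQ : ∀ q {q′} → ¬ SigmaQ (embQ q) q′
no-σ-on-embQ r⁻          ()
no-σ-on-embQ (t⁻ _ _)    ()
no-σ-on-embQ ba⁻         ()
no-σ-on-embQ bb⁻         ()
no-σ-on-embQ ti⁻         ()
no-σ-on-embQ (lamq⁻ _)   ()
no-σ-on-embQ (appq⁻ _ _) ()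
no-σ-on-embQ (letq⁻ _ _) ()
no-σ-on-embQ (trq⁻ _)    ()

mutual
  embQ-στ⇒τ : ∀ q {q′} → embQ q →στq q′ → embQ q TA.⇒q q′
  embQ-στ⇒τ (t⁻ q _)    (ST.tL p)            = TA.tL (embQ-στ⇒τ q p)
  embQ-στ⇒τ (t⁻ _ q)    (ST.tR p)            = TA.tR (embQ-στ⇒τ q p)
  embQ-στ⇒τ (lamq⁻ q)   (ST.lamqC p)         = TA.lamqC (embQ-στ⇒τ q p)
  embQ-στ⇒τ (appq⁻ q _) (ST.appqL p)         = TA.appqL (embQ-στ⇒τ q p)
  embQ-στ⇒τ (appq⁻ _ q) (ST.appqR p)         = TA.appqR (embQ-στ⇒τ q p)
  embQ-στ⇒τ (letq⁻ q _) (ST.letqL p)         = TA.letqL (embQ-στ⇒τ q p)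
  embQ-στ⇒τ (letq⁻ _ q) (ST.letqR p)         = TA.letqR (embQ-στ⇒τ q p)
  embQ-στ⇒τ (trq⁻ qs)   (ST.trqC i p)        = TA.trqC i (lookup-embQV-στ⇒τ qs i p)
  embQ-στ⇒τ q           (ST.rootQ (inj₁ x))  = ⊥-elim (no-σ-on-embQ q x)
  embQ-στ⇒τ q           (ST.rootQ (inj₂ x))  = TA.rootQ x

  lookup-embQV-στ⇒τ : ∀ {n} (qs : Vec PTr n) i {q′} →
                      lookup (embQV qs) i →στq q′ → lookup (embQV qs) i TA.⇒q q′
  lookup-embQV-στ⇒τ (q ∷ _)  zero    p = embQ-στ⇒τ q p
  lookup-embQV-στ⇒τ (_ ∷ qs) (suc i) p = lookup-embQV-στ⇒τ qs i p

lookup-embV : ∀ {n} (ms : Vec PTm n) i → lookup (embV ms) i ≡ emb (lookup ms i)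
lookup-embV (_ ∷ _)  zero    = refl
lookup-embV (_ ∷ ms) (suc i) = lookup-embV ms i

embV-[]≔ : ∀ {n} (ms : Vec PTm n) i M → embV (ms [ i ]≔ M) ≡ embV ms [ i ]≔ emb M
embV-[]≔ (_ ∷ _)  zero    M = refl
embV-[]≔ (m ∷ ms) (suc i) M = cong (emb m ∷_) (embV-[]≔ ms i M)

module _ {A : Set} where

  data OnePlace (R : A → A → Set) : ∀ {n} → Vec A n → Vec A n → Set where
    here  : ∀ {n x y} {xs : Vec A n} → R x y → OnePlace R (x ∷ xs) (y ∷ xs)
    there : ∀ {n x} {xs ys : Vec A n} → OnePlace R xs ys → OnePlace R (x ∷ xs) (x ∷ ys)

  private variable
    R : A → A → Set
    n : ℕ
    xs ys : Vec A n

  OnePlace⇒update : OnePlace R xs ys → ∃₂ λ i y → R (lookup xs i) y × ys ≡ xs [ i ]≔ y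
  OnePlace⇒update (here xRy) = zero , _ , xRy , refl
  OnePlace⇒update {xs = x ∷ _} (there p) =
    let i , y , xRy , eq = OnePlace⇒update p in suc i , y , xRy , cong (x ∷_) eq

  OnePlace-gmap : ∀ {B : Set} {S : B → B → Set} (f : Vec A n → B) →
                  (∀ {xs y} i → R (lookup xs i) y → S (f xs) (f (xs [ i ]≔ y))) →
                  OnePlace R xs ys → S (f xs) (f ys)
  OnePlace-gmap f rule p with OnePlace⇒update p
  ... | i , _ , xRy , refl = rule i xRy

  Pointwise⇒Star-OnePlace : Pointwise (Star R) xs ys → Star (OnePlace R) xs ys
  Pointwise⇒Star-OnePlace []       = ε
  Pointwise⇒Star-OnePlace (p ∷ ps) =
    Star.gmap (_∷ _) here p ◅◅ Star.gmap (_ ∷_) there (Pointwise⇒Star-OnePlace ps)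

  OnePlace-sym : OnePlace (SymClosure R) xs ys → SymClosure (OnePlace R) xs ys
  OnePlace-sym (here (fwd xRy)) = fwd (here xRy)
  OnePlace-sym (here (bwd yRx)) = bwd (here yRx)
  OnePlace-sym (there p)        = Sym.gmap (_ ∷_) there (OnePlace-sym p)

  Pointwise⇒EqClosure-OnePlace : Pointwise (EqClosure R) xs ys → EqClosure (OnePlace R) xs ys
  Pointwise⇒EqClosure-OnePlace = Star.map OnePlace-sym ∘ Pointwise⇒Star-OnePlace

  Pointwise-[]≔ : Reflexive R → (xs : Vec A n) (i : Fin n) → ∀ {a b} → R a b →
                  Pointwise R (xs [ i ]≔ a) (xs [ i ]≔ b)
  Pointwise-[]≔ R-refl (_ ∷ _)  zero    aRb = aRb ∷ Pointwise.refl R-refl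
  Pointwise-[]≔ R-refl (_ ∷ xs) (suc i) aRb = R-refl ∷ Pointwise-[]≔ R-refl xs i aRb

infix 4 _≈_ _≈ₛ_ _↠q_

_≈_ : Tm → Tm → Set
_≈_ = EqClosure _→στ_

_≈ₛ_ : Sb → Sb → Set
_≈ₛ_ = EqClosure ST._⇒s_

_↠q_ : Tr → Tr → Set
_↠q_ = Star _→στq_

lam-cong : ∀ {M M′} → M ≈ M′ → lam M ≈ lam M′
lam-cong = Eq.gmap lam ST.lamC

app-cong : ∀ {M M′ N N′} → M ≈ M′ → N ≈ N′ → app M N ≈ app M′ N′
app-cong {M′ = M′} {N = N} p q = Eq.gmap (λ x → app x N) ST.appL p ◅◅ Eq.gmap (app M′) ST.appR q

let-cong : ∀ {M M′ N N′} → M ≈ M′ → N ≈ N′ → letT M N ≈ letT M′ N′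
let-cong {M′ = M′} {N = N} p q = Eq.gmap (λ x → letT x N) ST.letL p ◅◅ Eq.gmap (letT M′) ST.letR q

bang-cong : ∀ {q M M′} → M ≈ M′ → bang q M ≈ bang q M′
bang-cong {q} = Eq.gmap (bang q) ST.bangM

tri-cong : ∀ {q M M′} → M ≈ M′ → tri q M ≈ tri q M′
tri-cong {q} = Eq.gmap (tri q) ST.triM

tri-trail-cong : ∀ {q q′ M} → q ↠q q′ → tri q M ≈ tri q′ M
tri-trail-cong {M = M} = Star.map fwd ∘ Star.gmap (λ x → tri x M) ST.triQ

iota-cong : ∀ {ms ms′} → Pointwise _≈_ ms ms′ → iota ms ≈ iota ms′
iota-cong = Eq.gmap iota (OnePlace-gmap {S = _→στ_} iota ST.iotaC) ∘ Pointwise⇒EqClosure-OnePlace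

sub-congˡ : ∀ {M M′ s} → M ≈ M′ → sub M s ≈ sub M′ s
sub-congˡ {s = s} = Eq.gmap (λ x → sub x s) ST.subM

sub-congʳ : ∀ {M s s′} → s ≈ₛ s′ → sub M s ≈ sub M s′
sub-congʳ {M} = Eq.gmap (sub M) ST.subS

comp-congʳ : ∀ {s u u′} → u ≈ₛ u′ → comp s u ≈ₛ comp s u′
comp-congʳ {s} = Eq.gmap (comp s) ST.compR

t-congˡ : ∀ {q q′ p} → q ↠q q′ → t q p ↠q t q′ p
t-congˡ {p = p} = Star.gmap (λ x → t x p) ST.tL

lamq-↠r : ∀ {q} → q ↠q r → lamq q ↠q r
lamq-↠r p = Star.gmap lamq ST.lamqC p ◅◅ τq-step τ-lamr ◅ ε

appq-↠r : ∀ {q p} → q ↠q r → p ↠q r → appq q p ↠q r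
appq-↠r {p = p} q↠r p↠r =
  Star.gmap (λ x → appq x p) ST.appqL q↠r ◅◅ Star.gmap (appq r) ST.appqR p↠r ◅◅
  τq-step τ-appr ◅ ε

letq-↠r : ∀ {q p} → q ↠q r → p ↠q r → letq q p ↠q r
letq-↠r {p = p} q↠r p↠r =
  Star.gmap (λ x → letq x p) ST.letqL q↠r ◅◅ Star.gmap (letq r) ST.letqR p↠r ◅◅
  τq-step τ-letr ◅ ε

trq-↠r : ∀ {qs} → Pointwise _↠q_ qs (replicate 9 r) → trq qs ↠q r
trq-↠r ps =
  Star.gmap trq (OnePlace-gmap {S = _→στq_} trq ST.trqC) (Pointwise⇒Star-OnePlace ps) ◅◅
  τq-step τ-trr ◅ ε

ups-cons : ∀ m X u → comp (ups (suc m)) (cons X u) ≈ₛ comp (ups m) u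
ups-cons zero    X u = fwd (ST.rootS c-assoc) ◅ comp-congʳ (Eq.return (ST.rootS c-upcons))
ups-cons (suc m) X u =
  fwd (ST.rootS c-assoc) ◅ comp-congʳ (ups-cons m X u) ◅◅ bwd (ST.rootS c-assoc) ◅ ε

ups-up : ∀ m → comp (ups m) up ≈ₛ ups (suc m)
ups-up zero    = ε
ups-up (suc m) = fwd (ST.rootS c-assoc) ◅ comp-congʳ (ups-up m)

ups-nil : ∀ m → comp (ups m) nil ≈ₛ ups m
ups-nil zero    = Eq.return (ST.rootS c-upnil)
ups-nil (suc m) = fwd (ST.rootS c-assoc) ◅ comp-congʳ (ups-nil m)

var-cons : ∀ n X u → sub (emb (v (suc n))) (cons X u) ≈ sub (emb (v n)) u
var-cons zero    X u = fwd (σ-step s-clos) ◅ sub-congʳ (Eq.return (ST.rootS c-upcons))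
var-cons (suc m) X u = fwd (σ-step s-clos) ◅ sub-congʳ (ups-cons m X u) ◅◅ bwd (σ-step s-clos) ◅ ε

var-nil : ∀ n → sub (emb (v n)) nil ≈ emb (v n)
var-nil zero    = Eq.return (σ-step s-id)
var-nil (suc m) = fwd (σ-step s-clos) ◅ sub-congʳ (ups-nil m)

Renames : Sb → (ℕ → ℕ) → Set
Renames s ρ = ∀ n → sub (emb (v n)) s ≈ emb (v (ρ n))

up-Renames-suc : Renames up suc
up-Renames-suc zero    = ε
up-Renames-suc (suc m) = fwd (σ-step s-clos) ◅ sub-congʳ (ups-up m)

Renames-lift : ∀ {s ρ} → Renames s ρ → Renames (cons one (comp s up)) (ext ρ)
Renames-lift h zero    = Eq.return (σ-step s-cons)
Renames-lift {s} {ρ} h (suc n) =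
  var-cons n one (comp s up) ◅◅ bwd (σ-step s-clos) ◅ sub-congˡ (h n) ◅◅ up-Renames-suc (ρ n)

mutual
  sub-rename : ∀ M {s ρ} → Renames s ρ → sub (emb M) s ≈ emb (rename ρ M)
  sub-rename (v n)       h = h n
  sub-rename (lam⁻ M)    h = fwd (σ-step s-lam) ◅ lam-cong (sub-rename M (Renames-lift h))
  sub-rename (app⁻ M N)  h = fwd (σ-step s-app) ◅ app-cong (sub-rename M h) (sub-rename N h)
  sub-rename (let⁻ M N)  h =
    fwd (σ-step s-let) ◅ let-cong (sub-rename M h) (sub-rename N (Renames-lift h))
  sub-rename (bang⁻ q M) h = fwd (σ-step s-bang) ◅ bang-cong (sub-rename M h)
  sub-rename (tri⁻ q M)  h = fwd (σ-step s-tri) ◅ tri-cong (sub-rename M h)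
  sub-rename (iota⁻ ms)  h = fwd (σ-step s-iota) ◅ iota-cong (sub-renameV ms h)

  sub-renameV : ∀ {n} (ms : Vec PTm n) {s ρ} → Renames s ρ →
                Pointwise _≈_ (map (λ M → sub M s) (embV ms)) (embV (renameV ρ ms))
  sub-renameV []       h = []
  sub-renameV (m ∷ ms) h = sub-rename m h ∷ sub-renameV ms h

Substitutes : Sb → (ℕ → PTm) → Set
Substitutes s σ = ∀ n → sub (emb (v n)) s ≈ emb (σ n)

Substitutes-lift : ∀ {s σ} → Substitutes s σ → Substitutes (cons one (comp s up)) (exts σ)
Substitutes-lift h zero    = Eq.return (σ-step s-cons)
Substitutes-lift {s} {σ} h (suc n) =
  var-cons n one (comp s up) ◅◅ bwd (σ-step s-clos) ◅ sub-congˡ (h n) ◅◅ sub-rename (σ n) up-Renames-suc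

Substitutes-single : ∀ {X N} → X ≈ emb N → Substitutes (cons X nil) (single N)
Substitutes-single X≈N zero    = fwd (σ-step s-cons) ◅ X≈N
Substitutes-single {X} X≈N (suc n) = var-cons n X nil ◅◅ var-nil n

mutual
  sub-subst : ∀ M {s σ} → Substitutes s σ → sub (emb M) s ≈ emb (subst σ M)
  sub-subst (v n)       h = h n
  sub-subst (lam⁻ M)    h = fwd (σ-step s-lam) ◅ lam-cong (sub-subst M (Substitutes-lift h))
  sub-subst (app⁻ M N)  h = fwd (σ-step s-app) ◅ app-cong (sub-subst M h) (sub-subst N h)
  sub-subst (let⁻ M N)  h =
    fwd (σ-step s-let) ◅ let-cong (sub-subst M h) (sub-subst N (Substitutes-lift h))
  sub-subst (bang⁻ q M) h = fwd (σ-step s-bang) ◅ bang-cong (sub-subst M h)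
  sub-subst (tri⁻ q M)  h = fwd (σ-step s-tri) ◅ tri-cong (sub-subst M h)
  sub-subst (iota⁻ ms)  h = fwd (σ-step s-iota) ◅ iota-cong (sub-substV ms h)

  sub-substV : ∀ {n} (ms : Vec PTm n) {s σ} → Substitutes s σ →
               Pointwise _≈_ (map (λ M → sub M s) (embV ms)) (embV (substV σ ms))
  sub-substV []       h = []
  sub-substV (m ∷ ms) h = sub-subst m h ∷ sub-substV ms h

τNormal : PTm → Set
τNormal M = ∀ W → ¬ (emb M →τ W)

στNormal⇒τNormal : ∀ {M} → NormalT (emb M) → τNormal M
στNormal⇒τNormal nf W = nf W ∘ τ⇒στ

IsTri : PTm → Set
IsTri M = ∃₂ λ q N → M ≡ tri⁻ q N

-- Bodies of ! are unconstrained: er and tl stop at a !.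
data TriFree : PTm → Set where
  v     : ∀ {n} → TriFree (v n)
  lam⁻  : ∀ {M} → TriFree M → TriFree (lam⁻ M)
  app⁻  : ∀ {M N} → TriFree M → TriFree N → TriFree (app⁻ M N)
  let⁻  : ∀ {M N} → TriFree M → TriFree N → TriFree (let⁻ M N)
  bang⁻ : ∀ {q M} → TriFree (bang⁻ q M)
  iota⁻ : ∀ {ms} → All TriFree ms → TriFree (iota⁻ ms)

iota-entry-τNormal : ∀ ms → τNormal (iota⁻ ms) →
                     ∀ i → τNormal (lookup ms i) × ¬ IsTri (lookup ms i)
iota-entry-τNormal ms nf i =
  (λ W st → nf _ (TA.iotaC i (≡.subst (TA._⇒t W) (sym (lookup-embV ms i)) st))) ,
  λ { (_ , _ , eq) → nf _ (TA.rootT (τ-iota i (trans (lookup-embV ms i) (cong emb eq)))) }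

mutual
  τNormal⇒TriFree : ∀ M → τNormal M → ¬ IsTri M → TriFree M
  τNormal⇒TriFree (v _) _ _ = v
  τNormal⇒TriFree (lam⁻ M) nf _ =
    lam⁻ (τNormal⇒TriFree M (λ W → nf _ ∘ TA.lamC) λ { (_ , _ , refl) → nf _ (TA.rootT τ-lam) })
  τNormal⇒TriFree (app⁻ M N) nf _ =
    app⁻ (τNormal⇒TriFree M (λ W → nf _ ∘ TA.appL) λ { (_ , _ , refl) → nf _ (TA.rootT τ-appL) })
         (τNormal⇒TriFree N (λ W → nf _ ∘ TA.appR) λ { (_ , _ , refl) → nf _ (TA.rootT τ-appR) })
  τNormal⇒TriFree (let⁻ M N) nf _ =
    let⁻ (τNormal⇒TriFree M (λ W → nf _ ∘ TA.letL) λ { (_ , _ , refl) → nf _ (TA.rootT τ-letL) })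
         (τNormal⇒TriFree N (λ W → nf _ ∘ TA.letR) λ { (_ , _ , refl) → nf _ (TA.rootT τ-letR) })
  τNormal⇒TriFree (bang⁻ _ _) _ _ = bang⁻
  τNormal⇒TriFree (tri⁻ q M) _ ¬tri = ⊥-elim (¬tri (q , M , refl))
  τNormal⇒TriFree (iota⁻ ms) nf _ = iota⁻ (τNormal⇒All-TriFree ms (iota-entry-τNormal ms nf))

  τNormal⇒All-TriFree : ∀ {n} (ms : Vec PTm n) →
                        (∀ i → τNormal (lookup ms i) × ¬ IsTri (lookup ms i)) → All TriFree ms
  τNormal⇒All-TriFree []       h = []
  τNormal⇒All-TriFree (m ∷ ms) h =
    τNormal⇒TriFree m (proj₁ (h zero)) (proj₂ (h zero)) ∷ τNormal⇒All-TriFree ms (h ∘ suc)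

bang-body-TriFree : ∀ {q} M → τNormal (bang⁻ q M) → TriFree M
bang-body-TriFree M nf =
  τNormal⇒TriFree M (λ W → nf _ ∘ TA.bangM) λ { (_ , _ , refl) → nf _ (TA.rootT τ-bang) }

mutual
  er-emb : ∀ {M} → TriFree M → er (emb M) ≈ emb M
  er-emb (v {zero})    = Eq.return (σ-step er-one)
  er-emb (v {suc n})   = Eq.return (σ-step (er-var n))
  er-emb (lam⁻ p)      = fwd (σ-step er-lam) ◅ lam-cong (er-emb p)
  er-emb (app⁻ p p′)   = fwd (σ-step er-app) ◅ app-cong (er-emb p) (er-emb p′)
  er-emb (let⁻ p p′)   = fwd (σ-step er-let) ◅ let-cong (er-emb p) (er-emb p′)
  er-emb bang⁻         = Eq.return (σ-step er-bang)
  er-emb (iota⁻ ps)    = fwd (σ-step er-iota) ◅ iota-cong (er-embV ps)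

  er-embV : ∀ {n} {ms : Vec PTm n} → All TriFree ms → Pointwise _≈_ (map er (embV ms)) (embV ms)
  er-embV []       = []
  er-embV (p ∷ ps) = er-emb p ∷ er-embV ps

mutual
  tl-emb : ∀ {M} → TriFree M → tl (emb M) ↠q r
  tl-emb (v {zero})  = σq-step tl-one ◅ ε
  tl-emb (v {suc n}) = σq-step (tl-var n) ◅ ε
  tl-emb (lam⁻ p)    = σq-step tl-lam ◅ lamq-↠r (tl-emb p)
  tl-emb (app⁻ p p′) = σq-step tl-app ◅ appq-↠r (tl-emb p) (tl-emb p′)
  tl-emb (let⁻ p p′) = σq-step tl-let ◅ letq-↠r (tl-emb p) (tl-emb p′)
  tl-emb bang⁻       = σq-step tl-bang ◅ ε
  tl-emb (iota⁻ ps)  = σq-step tl-iota ◅ trq-↠r (tl-embV ps)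

  tl-embV : ∀ {n} {ms : Vec PTm n} → All TriFree ms →
            Pointwise _↠q_ (map tl (embV ms)) (replicate n r)
  tl-embV []       = []
  tl-embV (p ∷ ps) = tl-emb p ∷ tl-embV ps

emb-foldl : ∀ a (xs : List PTm) → emb (foldl app⁻ a xs) ≡ foldl app (emb a) (mapₗ emb xs)
emb-foldl a []       = refl
emb-foldl a (x ∷ xs) = emb-foldl (app⁻ a x) xs

mutual
  emb-inspect : ∀ q θ → emb (inspect app⁻ q θ) ≡ inspect app q (embV θ)
  emb-inspect r⁻ θ          = sym (lookup-embV θ (# 0))
  emb-inspect (t⁻ a b) θ    =
    cong₂ app (cong₂ app (sym (lookup-embV θ (# 1))) (emb-inspect a θ)) (emb-inspect b θ)
  emb-inspect ba⁻ θ         = sym (lookup-embV θ (# 2))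
  emb-inspect bb⁻ θ         = sym (lookup-embV θ (# 3))
  emb-inspect ti⁻ θ         = sym (lookup-embV θ (# 4))
  emb-inspect (lamq⁻ a) θ   = cong₂ app (sym (lookup-embV θ (# 5))) (emb-inspect a θ)
  emb-inspect (appq⁻ a b) θ =
    cong₂ app (cong₂ app (sym (lookup-embV θ (# 6))) (emb-inspect a θ)) (emb-inspect b θ)
  emb-inspect (letq⁻ a b) θ =
    cong₂ app (cong₂ app (sym (lookup-embV θ (# 7))) (emb-inspect a θ)) (emb-inspect b θ)
  emb-inspect (trq⁻ qs) θ   =
    trans (emb-foldl (lookup θ (# 8)) (toList (inspectV app⁻ qs θ)))
          (cong₂ (foldl app) (sym (lookup-embV θ (# 8))) (emb-inspectV qs θ))

  emb-inspectV : ∀ {n} (qs : Vec PTr n) θ →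
                 mapₗ emb (toList (inspectV app⁻ qs θ)) ≡ toList (inspectV app qs (embV θ))
  emb-inspectV []       θ = refl
  emb-inspectV (q ∷ qs) θ = cong₂ _∷_ (emb-inspect q θ) (emb-inspectV qs θ)

embF : PFCtx → FCtx
embF hole⁻           = hole
embF (lamF⁻ F)       = lamF (embF F)
embF (appFL⁻ F N)    = appFL (embF F) (emb N)
embF (appFR⁻ M F)    = appFR (emb M) (embF F)
embF (letFL⁻ F N)    = letFL (embF F) (emb N)
embF (letFR⁻ M F)    = letFR (emb M) (embF F)
embF (triF⁻ q F)     = triF (embQ q) (embF F)
embF (iotaF⁻ ms i F) = iotaF (embV ms) i (embF F)

plugF-embF : ∀ F X → plugF (embF F) (emb X) ≡ emb (plugF⁻ F X)
plugF-embF hole⁻           X = refl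
plugF-embF (lamF⁻ F)       X = cong lam (plugF-embF F X)
plugF-embF (appFL⁻ F N)    X = cong (λ z → app z (emb N)) (plugF-embF F X)
plugF-embF (appFR⁻ M F)    X = cong (app (emb M)) (plugF-embF F X)
plugF-embF (letFL⁻ F N)    X = cong (λ z → letT z (emb N)) (plugF-embF F X)
plugF-embF (letFR⁻ M F)    X = cong (letT (emb M)) (plugF-embF F X)
plugF-embF (triF⁻ q F)     X = cong (tri (embQ q)) (plugF-embF F X)
plugF-embF (iotaF⁻ ms i F) X =
  cong iota (trans (cong (embV ms [ i ]≔_) (plugF-embF F X)) (sym (embV-[]≔ ms i (plugF⁻ F X))))

infix 4 _→B≈_

_→B≈_ : Tm → Tm → Set
X →B≈ Y = ∃ λ T → (X →B T) × (T ≈ Y)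

→B≈-cong : ∀ {X Y} (f : Tm → Tm) → (∀ {a b} → a →B b → f a →B f b) →
           (∀ {a b} → a ≈ b → f a ≈ f b) → X →B≈ Y → f X →B≈ f Y
→B≈-cong f fB f≈ (T , X→T , T≈Y) = f T , fB X→T , f≈ T≈Y

βRoot-simulation : ∀ {X Z} → τNormal X → βRoot X Z → emb X →B≈ emb Z
βRoot-simulation nf (β-lam {M} {N}) with τNormal⇒TriFree _ nf (λ { (_ , _ , ()) })
... | app⁻ (lam⁻ M-free) N-free =
  _ , rootB b-lam ,
  tri-trail-cong (t-congˡ (appq-↠r (lamq-↠r (tl-emb M-free)) (tl-emb N-free)) ◅◅ τq-step τ-rt ◅ ε) ◅◅
  tri-cong (sub-congˡ (er-emb M-free) ◅◅ sub-subst M (Substitutes-single (er-emb N-free)))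
βRoot-simulation nf (β-let {N = N}) with τNormal⇒TriFree _ nf (λ { (_ , _ , ()) })
... | let⁻ bang⁻ N-free =
  _ , rootB b-let ,
  tri-trail-cong (t-congˡ (letq-↠r ε (tl-emb N-free)) ◅◅ τq-step τ-rt ◅ ε) ◅◅
  tri-cong (sub-congˡ (er-emb N-free) ◅◅ sub-subst N (Substitutes-single ε))
βRoot-simulation nf (β-iota {q} F θ) =
  _ , subst₂ _→B_ (cong (bang (embQ q)) (plugF-embF F (iota⁻ θ))) (cong (bang (embQ q)) contractum)
                  (rootB (b-iota (embF F) (embV θ) q trail-normal)) ,
  ε
  where
  contractum : plugF (embF F) (tri ti (inspect app q (embV θ))) ≡
               emb (plugF⁻ F (tri⁻ ti⁻ (inspect app⁻ q θ)))
  contractum = trans (cong (λ z → plugF (embF F) (tri ti z)) (sym (emb-inspect q θ)))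
                     (plugF-embF F (tri⁻ ti⁻ (inspect app⁻ q θ)))

  -- σ(t(q, tl(F[ι(ϑ)]))) is q itself, so the inspected trail is the CAU⁻ one.
  trail-normal : IsστNFq (t (embQ q) (tl (plugF (embF F) (iota (embV θ))))) (embQ q)
  trail-normal =
    ≡.subst (λ z → t (embQ q) (tl z) ↠q embQ q) (sym (plugF-embF F (iota⁻ θ)))
            (Star.gmap (t (embQ q)) ST.tR (tl-emb (bang-body-TriFree _ nf)) ◅◅ τq-step τ-tr ◅ ε) ,
    λ q′ → nf _ ∘ TA.bangQ ∘ embQ-στ⇒τ q

β-simulation : ∀ {X Z} → τNormal X → X →β Z → emb X →B≈ emb Z
β-simulation nf (rootβ root) = βRoot-simulation nf root
β-simulation nf (lamβ p) = →B≈-cong lam lamB lam-cong (β-simulation (λ W → nf _ ∘ TA.lamC) p)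
β-simulation nf (appβL {N = N} p) =
  →B≈-cong (λ x → app x (emb N)) appBL (λ e → app-cong e ε) (β-simulation (λ W → nf _ ∘ TA.appL) p)
β-simulation nf (appβR {M} p) =
  →B≈-cong (app (emb M)) appBR (app-cong ε) (β-simulation (λ W → nf _ ∘ TA.appR) p)
β-simulation nf (letβL {N = N} p) =
  →B≈-cong (λ x → letT x (emb N)) letBL (λ e → let-cong e ε) (β-simulation (λ W → nf _ ∘ TA.letL) p)
β-simulation nf (letβR {M} p) =
  →B≈-cong (letT (emb M)) letBR (let-cong ε) (β-simulation (λ W → nf _ ∘ TA.letR) p)
β-simulation nf (bangβ {q} p) =
  →B≈-cong (bang (embQ q)) bangB bang-cong (β-simulation (λ W → nf _ ∘ TA.bangM) p)
β-simulation nf (triβ {q} p) =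
  →B≈-cong (tri (embQ q)) triB tri-cong (β-simulation (λ W → nf _ ∘ TA.triM) p)
β-simulation nf (iotaβ {ms} {M′} i p) =
  let T , entry→T , T≈M′ = β-simulation (proj₁ (iota-entry-τNormal ms nf i)) p in
  iota (embV ms [ i ]≔ T) ,
  iotaB i (≡.subst (_→B T) (sym (lookup-embV ms i)) entry→T) ,
  iota-cong (≡.subst (Pointwise _≈_ _) (sym (embV-[]≔ ms i M′)) (Pointwise-[]≔ ε (embV ms) i T≈M′))

→⁻*⇒→σ* : ∀ {X Y} → τNormal X → X →⁻* Y → emb X →σ* emb Y
→⁻*⇒→σ* nf ε = ε
→⁻*⇒→σ* nf ((_ , X→βZ , Z↠τY , Y-normal) ◅ Y→⁻*) =
  let T , X→T , T≈Z = β-simulation nf X→βZ in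
  inj₁ X→T ◅ inj₂ (T≈Z ◅◅ Star.map (fwd ∘ τ⇒στ) Z↠τY) ◅ →⁻*⇒→σ* Y-normal Y→⁻*

στ*⇒→σ* : ∀ {X Y} → Star _→στ_ X Y → X →σ* Y
στ*⇒→σ* = Star.map (inj₂ ∘ Eq.return)

theorem4 : ∀ {M N R : Tm} → M →σ* N → M →σ* R →
           (N' R' : PTm) → IsστNF N (emb N') → IsστNF R (emb R') →
           (∃ λ S → (N' →⁻* S) × (R' →⁻* S)) →
           ∃ λ S' → (N →σ* S') × (R →σ* S')
theorem4 _ _ N′ R′ (N↠N′ , N′-normal) (R↠R′ , R′-normal) (S , N′→⁻*S , R′→⁻*S) =
  emb S ,
  στ*⇒→σ* N↠N′ ◅◅ →⁻*⇒→σ* (στNormal⇒τNormal N′-normal) N′→⁻*S ,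
  στ*⇒→σ* R↠R′ ◅◅ →⁻*⇒→σ* (στNormal⇒τNormal R′-normal) R′→⁻*S
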